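{- Let $\mathcal A$ be a stable semi-SCT MCS. Then the MCS $\mathcal A'$ obtained by applying a partial elaboration step to $\mathcal A$ is also stable.
   Context: Fix variables $x_1,\dots,x_n$, primed copies $x_i'$. An MC is a conjunction of constraints $x\bowtie y$ ($x,y\in\{x_i,x_i'\}$, ${\bowtie}\in\{>,\ge,=\}$). An MCS: a finite directed multigraph on flow-points $F$ with arcs labelled by MCs ($G:f\to g$) and invariants $I_f$ (conjunctions of order constraints among $x_1,\dots,x_n$). A transition $(f,\sigma)\mapsto(g,\sigma')$ satisfies $G:f\to g$ if $\sigma\models I_f$, $\sigma'\models I_g$, $\sigma,\sigma'\models G$ ($\sigma,\sigma':\{1..n\}\to\mathbb Z$); an MC is satisfiable if some transition satisfies it. $G\vdash P$: every transition satisfying $G$ satisfies $P$. MCs are identified with their consequence closures (every relation implied, taking invariants into account, is explicitly included). The MCS is stable if every MC is satisfiable, and for every $G:f\to g$, ${\rhd}\in\{>,\ge\}$: $G\vdash x_i\rhd x_j\Rightarrow I_f\vdash x_i\rhd x_j$ and $G\vdash x_i'\rhd x_j'\Rightarrow I_g\vdash x_i\rhd x_j$. The MCS is semi-SCT if none of its MCs contains a constraint of the form $x_i<x_j'$ or $x_i\le x_j'$. A partial elaboration step: given a flow-point $f$ and conjunctions of order constraints $I_1,\dots,I_k$ over $x_1,\dots,x_n$ that are mutually exclusive with $I_1\vee\cdots\vee I_k\equiv I_f$, split $f$ into $k$ flow-points $f_1,\dots,f_k$ with invariants $I_1,\dots,I_k$, replicate every MC leaving or entering $f$ accordingly, close each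 replicated MC under consequence with respect to its new source/target invariant, and remove those that become unsatisfiable. -}

module Defs where

open import Data.Nat using (ℕ)
open import Data.Integer using (ℤ) renaming (_<_ to _<ℤ_; _≤_ to _≤ℤ_)
open import Data.Fin using (Fin)
open import Data.List using (List)
open import Data.List.Relation.Unary.All using (All)
open import Data.Product using (Σ; Σ-syntax; ∃; _×_; _,_)
open import Relation.Binary.PropositionalEquality using (_≡_; _≢_)
open import Relation.Nullary using (¬_)
open import Function.Bundles using (_⇔_)

data Atom (V : Set) : Set where
  _>ᶜ_ : V → V → Atom V
  _≥ᶜ_ : V → V → Atom V
  _=ᶜ_ : V → V → Atom V

⟦_⟧ᵃ : {V : Set} → Atom V → (V → ℤ) → Set
⟦ x >ᶜ y ⟧ᵃ ρ = ρ y <ℤ ρ x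
⟦ x ≥ᶜ y ⟧ᵃ ρ = ρ y ≤ℤ ρ x
⟦ x =ᶜ y ⟧ᵃ ρ = ρ x ≡ ρ y

Conj : Set → Set
Conj V = List (Atom V)

_⊨_ : {V : Set} → (V → ℤ) → Conj V → Set
ρ ⊨ C = All (λ a → ⟦ a ⟧ᵃ ρ) C

data Var (n : ℕ) : Set where
  unp : Fin n → Var n
  pr  : Fin n → Var n

Invariant : ℕ → Set
Invariant n = Conj (Fin n)

MC : ℕ → Set
MC n = Conj (Var n)

State : ℕ → Set
State n = Fin n → ℤ

pairVal : {n : ℕ} → State n → State n → Var n → ℤ
pairVal σ σ' (unp i) = σ i
pairVal σ σ' (pr i)  = σ' i

SatTrans : {n : ℕ} → Invariant n → Invariant n → MC n → State n → State n → Set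
SatTrans If Ig G σ σ' = (σ ⊨ If) × (σ' ⊨ Ig) × (pairVal σ σ' ⊨ G)

Satisfiable : {n : ℕ} → Invariant n → Invariant n → MC n → Set
Satisfiable If Ig G = Σ[ σ ∈ State _ ] Σ[ σ' ∈ State _ ] SatTrans If Ig G σ σ'

Entails : {n : ℕ} → Invariant n → Invariant n → MC n → Atom (Var n) → Set
Entails If Ig G P = ∀ σ σ' → SatTrans If Ig G σ σ' → ⟦ P ⟧ᵃ (pairVal σ σ')

InvEntails : {n : ℕ} → Invariant n → Atom (Fin n) → Set
InvEntails I P = ∀ (σ : State _) → σ ⊨ I → ⟦ P ⟧ᵃ σ

-- Each MC is identified with its consequence closure; accordingly "G contains
-- the constraint P" is read as Entails (I_src) (I_tgt) G P.
record MCS (n : ℕ) : Set₁ where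
  field
    FP   : Set
    inv  : FP → Invariant n
    Arc  : Set
    src  : Arc → FP
    tgt  : Arc → FP
    mc   : Arc → MC n

module _ {n : ℕ} (A : MCS n) where
  open MCS A

  ArcEntails : Arc → Atom (Var n) → Set
  ArcEntails a P = Entails (inv (src a)) (inv (tgt a)) (mc a) P

  Stable : Set
  Stable = ∀ (a : Arc) →
      Satisfiable (inv (src a)) (inv (tgt a)) (mc a)
    × (∀ (i j : Fin n) →
          (ArcEntails a (unp i >ᶜ unp j) → InvEntails (inv (src a)) (i >ᶜ j))
        × (ArcEntails a (unp i ≥ᶜ unp j) → InvEntails (inv (src a)) (i ≥ᶜ j))
        × (ArcEntails a (pr i >ᶜ pr j) → InvEntails (inv (tgt a)) (i >ᶜ j))
        × (ArcEntails a (pr i ≥ᶜ pr j) → InvEntails (inv (tgt a)) (i ≥ᶜ j)))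

  SemiSCT : Set
  SemiSCT = ∀ (a : Arc) (i j : Fin n) →
      ¬ ArcEntails a (pr j >ᶜ unp i) × ¬ ArcEntails a (pr j ≥ᶜ unp i)

  MutuallyExclusive : {k : ℕ} → (Fin k → Invariant n) → Set
  MutuallyExclusive J = ∀ i j → i ≢ j → ∀ (σ : State n) → ¬ ((σ ⊨ J i) × (σ ⊨ J j))

  CoversInv : (f : FP) → {k : ℕ} → (Fin k → Invariant n) → Set
  CoversInv f J = ∀ (σ : State n) → (σ ⊨ inv f) ⇔ (∃ λ i → σ ⊨ J i)

  module Elab (f : FP) (k : ℕ) (J : Fin k → Invariant n) where
    data Lift (g : FP) : Set where
      keep  : g ≢ f → Lift g
      split : g ≡ f → Fin k → Lift g

    NewFP : Set
    NewFP = Σ FP Lift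

    newInv : NewFP → Invariant n
    newInv (g , keep _)    = inv g
    newInv (g , split _ i) = J i

    -- Replicas of an arc a : g → h: one for each choice of copies of its
    -- endpoints; the MC label is unchanged, and is implicitly closed w.r.t. the
    -- new invariants. Unsatisfiable replicas are removed.
    NewArc : Set
    NewArc = Σ[ a ∈ Arc ] Σ[ s ∈ Lift (src a) ] Σ[ t ∈ Lift (tgt a) ]
               Satisfiable (newInv (src a , s)) (newInv (tgt a , t)) (mc a)

  partialElab : (f : FP) (k : ℕ) (J : Fin k → Invariant n) → MCS n
  partialElab f k J = record
    { FP  = E.NewFP
    ; inv = E.newInv
    ; Arc = E.NewArc
    ; src = λ { (a , s , t , _) → (src a , s) }
    ; tgt = λ { (a , s , t , _) → (tgt a , t) }
    ; mc  = λ { (a , _) → mc a }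
    }
    where module E = Elab f k J

-- A replica of an arc keeps its MC and only strengthens the invariants of its
-- endpoints. Stability of an arc follows once every state satisfying its source
-- invariant extends to a transition (and dually for the target). Given a
-- transition (τ, τ') of a replica and a state σ satisfying the new source
-- invariant, shift τ' down by a large constant c: the unprimed constraints hold
-- at σ by stability of the original arc, the primed ones are invariant under
-- translation, and by semi-SCT the only mixed constraints are xᵢ > xⱼ' and
-- xᵢ ≥ xⱼ', which the shift enforces. Targets are handled by shifting τ up.
module Submission where

open import Data.Nat using (ℕ)
open import Data.Fin using (Fin)
open import Data.Integer using (ℤ; 0ℤ; -1ℤ; _+_; -_; _-_; pred; _<_; _≤_)
import Data.Integer.Properties as ℤ
open import Data.Integer.Tactic.RingSolver using (solve-∀)
open import Data.List using (tabulate)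
open import Data.List.Extrema ℤ.≤-totalOrder using (min; max; min≤xs; xs≤max)
open import Data.List.Relation.Unary.All as All using ()
open import Data.List.Relation.Unary.All.Properties using (tabulate⁻)
open import Data.List.Membership.Propositional using (_∈_)
open import Data.Product using (Σ-syntax; ∃; _×_; _,_; proj₁; proj₂)
open import Data.Empty using (⊥-elim)
open import Relation.Binary.PropositionalEquality using (_≡_; refl; sym; cong)
open import Relation.Nullary using (¬_)
open import Function.Base using (_∘_)
open import Function.Bundles using (Equivalence)
open import Defs

∃-lowerBound : ∀ {n} (x : Fin n → ℤ) → ∃ λ m → ∀ i → m ≤ x i
∃-lowerBound x = min 0ℤ (tabulate x) , tabulate⁻ (min≤xs 0ℤ (tabulate x))

∃-upperBound : ∀ {n} (x : Fin n → ℤ) → ∃ λ M → ∀ i → x i ≤ M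
∃-upperBound x = max 0ℤ (tabulate x) , tabulate⁻ (xs≤max 0ℤ (tabulate x))

∃-shift-below : ∀ {n} (x y : Fin n → ℤ) → ∃ λ c → ∀ i j → c + y j < x i
∃-shift-below x y = pred (m - M) , λ i j → begin-strict
    pred (m - M) + y j  ≤⟨ ℤ.+-monoʳ-≤ (pred (m - M)) (y≤M j) ⟩
    pred (m - M) + M    ≡⟨ cancel m M ⟩
    pred m              <⟨ ℤ.i≤pred[j]⇒i<j ℤ.≤-refl ⟩
    m                   ≤⟨ m≤x i ⟩
    x i                 ∎
  where
  open ℤ.≤-Reasoning
  m = proj₁ (∃-lowerBound x)
  m≤x = proj₂ (∃-lowerBound x)
  M = proj₁ (∃-upperBound y)
  y≤M = proj₂ (∃-upperBound y)
  cancel : ∀ m M → -1ℤ + (m - M) + M ≡ -1ℤ + m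
  cancel = solve-∀

∃-shift-above : ∀ {n} (x y : Fin n → ℤ) → ∃ λ c → ∀ i j → y j < c + x i
∃-shift-above x y = - c , λ i j → begin-strict
    y j              ≡⟨ cancel c (y j) ⟩
    - c + (c + y j)  <⟨ ℤ.+-monoʳ-< (- c) (below i j) ⟩
    - c + x i        ∎
  where
  open ℤ.≤-Reasoning
  c = proj₁ (∃-shift-below x y)
  below = proj₂ (∃-shift-below x y)
  cancel : ∀ c y → y ≡ - c + (c + y)
  cancel = solve-∀

shift : {V : Set} → ℤ → (V → ℤ) → V → ℤ
shift c ρ v = c + ρ v

shift-atom : ∀ {V} c {ρ : V → ℤ} (p : Atom V) → ⟦ p ⟧ᵃ ρ → ⟦ p ⟧ᵃ (shift c ρ)
shift-atom c (x >ᶜ y) = ℤ.+-monoʳ-< c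
shift-atom c (x ≥ᶜ y) = ℤ.+-monoʳ-≤ c
shift-atom c (x =ᶜ y) = cong (c +_)

shift-⊨ : ∀ {V} c {ρ : V → ℤ} {C : Conj V} → ρ ⊨ C → shift c ρ ⊨ C
shift-⊨ c = All.map (λ {p} → shift-atom c p)

renameAtom : {V W : Set} → (V → W) → Atom V → Atom W
renameAtom r (x >ᶜ y) = r x >ᶜ r y
renameAtom r (x ≥ᶜ y) = r x ≥ᶜ r y
renameAtom r (x =ᶜ y) = r x =ᶜ r y

⟦renameAtom⟧ : ∀ {V W} (r : V → W) (p : Atom V) {ρ : W → ℤ} →
               ⟦ renameAtom r p ⟧ᵃ ρ → ⟦ p ⟧ᵃ (ρ ∘ r)
⟦renameAtom⟧ r (x >ᶜ y) h = h
⟦renameAtom⟧ r (x ≥ᶜ y) h = h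
⟦renameAtom⟧ r (x =ᶜ y) h = h

module _ {n : ℕ} {Is It : Invariant n} {G : MC n} where

  ∈⇒Entails : ∀ {P} → P ∈ G → Entails Is It G P
  ∈⇒Entails P∈G σ σ' (_ , _ , σσ'⊨G) = All.lookup σσ'⊨G P∈G

  Entails->⇒≥ : ∀ {x y} → Entails Is It G (x >ᶜ y) → Entails Is It G (x ≥ᶜ y)
  Entails->⇒≥ e σ σ' tr = ℤ.<⇒≤ (e σ σ' tr)

  Entails-=⇒≥ : ∀ {x y} → Entails Is It G (x =ᶜ y) → Entails Is It G (x ≥ᶜ y)
  Entails-=⇒≥ e σ σ' tr = ℤ.≤-reflexive (sym (e σ σ' tr))

  Entails-=⇒≤ : ∀ {x y} → Entails Is It G (x =ᶜ y) → Entails Is It G (y ≥ᶜ x)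
  Entails-=⇒≤ e σ σ' tr = ℤ.≤-reflexive (e σ σ' tr)

  ⊨-semiSCT : (∀ i j → ¬ Entails Is It G (pr j ≥ᶜ unp i)) → (ρ : Var n → ℤ) →
    (∀ p → Entails Is It G (renameAtom unp p) → ⟦ p ⟧ᵃ (ρ ∘ unp)) →
    (∀ p → Entails Is It G (renameAtom pr p) → ⟦ p ⟧ᵃ (ρ ∘ pr)) →
    (∀ i j → ρ (pr j) < ρ (unp i)) → ρ ⊨ G
  ⊨-semiSCT noLower ρ unp-ok pr-ok separated =
      All.tabulate (λ {P} P∈G → holds P (∈⇒Entails P∈G))
    where
    holds : ∀ P → Entails Is It G P → ⟦ P ⟧ᵃ ρ
    holds (unp i >ᶜ unp j) = unp-ok (i >ᶜ j)
    holds (unp i ≥ᶜ unp j) = unp-ok (i ≥ᶜ j)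
    holds (unp i =ᶜ unp j) = unp-ok (i =ᶜ j)
    holds (pr i >ᶜ pr j)   = pr-ok (i >ᶜ j)
    holds (pr i ≥ᶜ pr j)   = pr-ok (i ≥ᶜ j)
    holds (pr i =ᶜ pr j)   = pr-ok (i =ᶜ j)
    holds (unp i >ᶜ pr j) _ = separated i j
    holds (unp i ≥ᶜ pr j) _ = ℤ.<⇒≤ (separated i j)
    holds (unp i =ᶜ pr j) e = ⊥-elim (noLower i j (Entails-=⇒≤ {x = unp i} {y = pr j} e))
    holds (pr j >ᶜ unp i) e = ⊥-elim (noLower i j (Entails->⇒≥ {x = pr j} {y = unp i} e))
    holds (pr j ≥ᶜ unp i) e = ⊥-elim (noLower i j e)
    holds (pr j =ᶜ unp i) e = ⊥-elim (noLower i j (Entails-=⇒≥ {x = pr j} {y = unp i} e))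

  total⇒reflect-unp : (∀ σ → σ ⊨ Is → Σ[ σ' ∈ State n ] SatTrans Is It G σ σ') →
                ∀ p → Entails Is It G (renameAtom unp p) → InvEntails Is p
  total⇒reflect-unp extend p e σ σ⊨ with extend σ σ⊨
  ... | σ' , tr = ⟦renameAtom⟧ unp p (e σ σ' tr)

  total⇒reflect-pr : (∀ σ' → σ' ⊨ It → Σ[ σ ∈ State n ] SatTrans Is It G σ σ') →
               ∀ p → Entails Is It G (renameAtom pr p) → InvEntails It p
  total⇒reflect-pr extend p e σ' σ'⊨ with extend σ' σ'⊨
  ... | σ , tr = ⟦renameAtom⟧ pr p (e σ σ' tr)

module _ {n : ℕ} (A : MCS n) where
  open MCS A

  SourceTotal TargetTotal : Arc → Set
  SourceTotal a = ∀ σ → σ ⊨ inv (src a) →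
    Σ[ σ' ∈ State n ] SatTrans (inv (src a)) (inv (tgt a)) (mc a) σ σ'
  TargetTotal a = ∀ σ' → σ' ⊨ inv (tgt a) →
    Σ[ σ ∈ State n ] SatTrans (inv (src a)) (inv (tgt a)) (mc a) σ σ'

  stable-of-total : (∀ a → Satisfiable (inv (src a)) (inv (tgt a)) (mc a) ×
                           SourceTotal a × TargetTotal a) → Stable A
  stable-of-total total a with total a
  ... | sat , ext↓ , ext↑ = sat , λ i j →
      total⇒reflect-unp ext↓ (i >ᶜ j) , total⇒reflect-unp ext↓ (i ≥ᶜ j)
    , total⇒reflect-pr ext↑ (i >ᶜ j) , total⇒reflect-pr ext↑ (i ≥ᶜ j)

  Stable-reflect-unp : Stable A → ∀ a p →
    ArcEntails A a (renameAtom unp p) → InvEntails (inv (src a)) p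
  Stable-reflect-unp stable a (i >ᶜ j) = stable a .proj₂ i j .proj₁
  Stable-reflect-unp stable a (i ≥ᶜ j) = stable a .proj₂ i j .proj₂ .proj₁
  Stable-reflect-unp stable a (i =ᶜ j) e σ σ⊨ = ℤ.≤-antisym
    (Stable-reflect-unp stable a (j ≥ᶜ i) (Entails-=⇒≤ {x = unp i} {y = unp j} e) σ σ⊨)
    (Stable-reflect-unp stable a (i ≥ᶜ j) (Entails-=⇒≥ {x = unp i} {y = unp j} e) σ σ⊨)

  Stable-reflect-pr : Stable A → ∀ a p →
    ArcEntails A a (renameAtom pr p) → InvEntails (inv (tgt a)) p
  Stable-reflect-pr stable a (i >ᶜ j) = stable a .proj₂ i j .proj₂ .proj₂ .proj₁
  Stable-reflect-pr stable a (i ≥ᶜ j) = stable a .proj₂ i j .proj₂ .proj₂ .proj₂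
  Stable-reflect-pr stable a (i =ᶜ j) e σ σ⊨ = ℤ.≤-antisym
    (Stable-reflect-pr stable a (j ≥ᶜ i) (Entails-=⇒≤ {x = pr i} {y = pr j} e) σ σ⊨)
    (Stable-reflect-pr stable a (i ≥ᶜ j) (Entails-=⇒≥ {x = pr i} {y = pr j} e) σ σ⊨)

module _ {n : ℕ} (A : MCS n) (stable : Stable A) (semi : SemiSCT A)
         (f : MCS.FP A) (k : ℕ) (J : Fin k → Invariant n) (cov : CoversInv A f J)
         where
  open MCS A
  open Elab A f k J

  newInv⇒inv : ∀ {g} (l : Lift g) {σ} → σ ⊨ newInv (g , l) → σ ⊨ inv g
  newInv⇒inv (keep _)       σ⊨ = σ⊨
  newInv⇒inv (split refl i) {σ} σ⊨ = Equivalence.from (cov σ) (i , σ⊨)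

  private
    A' = partialElab A f k J

  extend-source : (e : NewArc) → SourceTotal A' e
  extend-source (a , s , t , τ , τ' , τ⊨ , τ'⊨ , ττ'⊨G) σ σ⊨ =
      shift c τ' , σ⊨ , shift-⊨ c τ'⊨ ,
      ⊨-semiSCT (λ i j → semi a i j .proj₂) (pairVal σ (shift c τ'))
        (λ p e → Stable-reflect-unp A stable a p e σ (newInv⇒inv s σ⊨))
        (λ p e → shift-atom c p (⟦renameAtom⟧ pr p (e τ τ' old)))
        (proj₂ (∃-shift-below σ τ'))
    where
    c = proj₁ (∃-shift-below σ τ')
    old = newInv⇒inv s τ⊨ , newInv⇒inv t τ'⊨ , ττ'⊨G

  extend-target : (e : NewArc) → TargetTotal A' e
  extend-target (a , s , t , τ , τ' , τ⊨ , τ'⊨ , ττ'⊨G) σ' σ'⊨ =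
      shift c τ , shift-⊨ c τ⊨ , σ'⊨ ,
      ⊨-semiSCT (λ i j → semi a i j .proj₂) (pairVal (shift c τ) σ')
        (λ p e → shift-atom c p (⟦renameAtom⟧ unp p (e τ τ' old)))
        (λ p e → Stable-reflect-pr A stable a p e σ' (newInv⇒inv t σ'⊨))
        (proj₂ (∃-shift-above τ σ'))
    where
    c = proj₁ (∃-shift-above τ σ')
    old = newInv⇒inv s τ⊨ , newInv⇒inv t τ'⊨ , ττ'⊨G

mainTheorem14 : ∀ {n : ℕ} (A : MCS n) → Stable A → SemiSCT A →
    (f : MCS.FP A) (k : ℕ) (J : Fin k → Invariant n) →
    MutuallyExclusive A J → CoversInv A f J →
    Stable (partialElab A f k J)
mainTheorem14 A stable semi f k J _ cov =
  stable-of-total (partialElab A f k J) λ e@(_ , _ , _ , sat) →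
    sat , extend-source A stable semi f k J cov e , extend-target A stable semi f k J cov e
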